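{- Let $\Gamma$ be a graph satisfying (P) and (N), let $\mathbb{H}$ be a $\{2,3\}$-hypergraph on $\mathfrak{C}(\Gamma)$ satisfying (E), and fix isomorphisms $\varphi_C:P_{v(C)}\to C$ for $C\in\mathfrak{C}(\Gamma)$. If $\mathbb{M}$ is a module of $\mathbb{H}$ with $\mathbb{M}\subseteq\mathfrak{C}_1(\Gamma)$, then $\overline{\mathbb{M}}$ is a module of $\Gamma\bullet\mathbb{H}$.
   Context: All structures are finite. A hypergraph $H$ has vertex set $V(H)$ and edge set $E(H)\subseteq 2^{V(H)}\setminus\{\emptyset\}$; $v(H)=|V(H)|$; 3-hypergraph: all edges have 3 elements; $\{2,3\}$-hypergraph: all edges have 2 or 3 elements. $M\subseteq V(H)$ is a module if for each $e\in E(H)$ with $e\cap M\neq\emptyset$, $e\setminus M\neq\emptyset$ there is $m\in M$ with $e\cap M=\{m\}$ and $(e\setminus\{m\})\cup\{n\}\in E(H)$ for all $n\in M$. For a $\{2,3\}$-hypergraph $\mathbb{H}$, $\mathbb{W}\subseteq V(\mathbb{H})$ is a module of $\mathbb{H}$ if it is a module both of $(V(\mathbb{H}),E(\mathbb{H})\cap\binom{V(\mathbb{H})}{2})$ and of $(V(\mathbb{H}),E(\mathbb{H})\cap\binom{V(\mathbb{H})}{3})$. For $\mathbb{W}\subseteq\mathfrak{C}(\Gamma)$, $\overline{\mathbb{W}}=\bigcup_{C\in\mathbb{W}}V(C)$. For a tournament $T$, $C_3(T)$ is the 3-hypergraph on $V(T)$ whose edges are the 3-sets inducing a 3-cycle.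 $L_m$: tournament on $\{0,\dots,m-1\}$ with arcs $ij$ for $i<j$; $U_{2n+1}$: obtained from $L_{2n+1}$ by reversing all arcs between two even vertices. Construction. $P_n$ is the path on $\{0,\ldots,n-1\}$ with edges $\{k,k+1\}$. For a graph $\Gamma$: $\mathfrak{C}(\Gamma)$ its components; $\mathfrak{C}_{\rm even}(\Gamma)$, $\mathfrak{C}_{\rm odd}(\Gamma)$ those with even/odd number of vertices; $\mathfrak{C}_1(\Gamma)$ the one-vertex components; $w(C)=\lfloor v(C)/2\rfloor$. (P): every component is a path. (N): $\mathfrak{C}(\Gamma)\setminus\mathfrak{C}_1(\Gamma)\neq\emptyset$; for each odd $C$, if $V(\Gamma)\setminus V(C)\neq\emptyset$ then $(\mathfrak{C}(\Gamma)\setminus\mathfrak{C}_1(\Gamma))\setminus\{C\}\neq\emptyset$; for each even $C$, if $|V(\Gamma)\setminus V(C)|\ge2$ then $(\mathfrak{C}(\Gamma)\setminus\mathfrak{C}_1(\Gamma))\setminus\{C\}\neq\emptyset$. (E): each 2-element edge of $\mathbb{H}$ contains one even and one odd component; each 3-element edge consists of odd components. $\Gamma\bullet\mathbb{H}$ is the 3-hypergraph on $V(\Gamma)$ whose edge set is the union of: (i) for each $C\in\mathfrak{C}_{\rm odd}(\Gamma)\setminus\mathfrak{C}_1(\Gamma)$, $\varphi_C(E(C_3(U_{v(C)})))$; (ii) for each edge $\{C,D\}$ of $\mathbb{H}$, $C$ even, $D$ odd, the sets $\{\varphi_C(2i),\varphi_C(2j+1),\varphi_D(2k)\}$, $0\le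 i\le j\le w(C)-1$, $0\le k\le w(D)$; (iii) for each edge $\{I,J,K\}$ of $\mathbb{H}$, the sets $\{\varphi_I(2i),\varphi_J(2j),\varphi_K(2k)\}$, $0\le i\le w(I)$, $0\le j\le w(J)$, $0\le k\le w(K)$. -}

module Defs where

open import Data.Nat using (ℕ; zero; suc; _+_; _*_; _∸_; _/_; _≤_; _<_)
open import Data.Fin using (Fin; toℕ)
open import Data.Fin.Subset using (Subset; _∈_; _∪_; _∩_; _─_; ⁅_⁆; ∣_∣; Nonempty)
open import Data.Product using (Σ; ∃; ∃-syntax; _×_; _,_; proj₁)
open import Data.Sum using (_⊎_)
open import Data.Vec using (tabulate; lookup)
open import Function.Bundles using (_↔_; Inverse)
open import Relation.Binary.PropositionalEquality using (_≡_; _≢_)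
open import Relation.Nullary using (¬_)

IsEven : ℕ → Set
IsEven m = ∃[ k ] m ≡ 2 * k

IsOdd : ℕ → Set
IsOdd m = ∃[ k ] m ≡ suc (2 * k)

EdgeSet : ℕ → Set₁
EdgeSet n = Subset n → Set

IsModule : ∀ {n} → EdgeSet n → Subset n → Set
IsModule {n} E M =
  ∀ e → E e → Nonempty (e ∩ M) → Nonempty (e ─ M) →
  Σ (Fin n) λ m → m ∈ M × (e ∩ M ≡ ⁅ m ⁆) ×
    (∀ x → x ∈ M → E ((e ─ ⁅ m ⁆) ∪ ⁅ x ⁆))

Is23Hypergraph : ∀ {n} → EdgeSet n → Set
Is23Hypergraph E = ∀ e → E e → (∣ e ∣ ≡ 2) ⊎ (∣ e ∣ ≡ 3)

IsModule23 : ∀ {n} → EdgeSet n → Subset n → Set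
IsModule23 E M =
  IsModule (λ e → E e × ∣ e ∣ ≡ 2) M × IsModule (λ e → E e × ∣ e ∣ ≡ 3) M

triple : ∀ {n} → Fin n → Fin n → Fin n → Subset n
triple x y z = ⁅ x ⁆ ∪ ⁅ y ⁆ ∪ ⁅ z ⁆

pair : ∀ {n} → Fin n → Fin n → Subset n
pair x y = ⁅ x ⁆ ∪ ⁅ y ⁆

Tournament : ℕ → Set₁
Tournament m = Fin m → Fin m → Set

L : (m : ℕ) → Tournament m
L m i j = toℕ i < toℕ j

-- U_m: L_m with all arcs between two even vertices reversed.
U : (m : ℕ) → Tournament m
U m i j = (IsEven (toℕ i) × IsEven (toℕ j) × toℕ j < toℕ i)
        ⊎ (¬ (IsEven (toℕ i) × IsEven (toℕ j)) × toℕ i < toℕ j)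

C3 : ∀ {m} → Tournament m → EdgeSet m
C3 T e = ∃[ a ] ∃[ b ] ∃[ c ] (T a b × T b c × T c a × e ≡ triple a b c)

-- Components are indexed by Fin c,
-- component C has size s C ≥ 1, vertex set of Γ is Fin n and φ is a
-- bijection Σ C, Fin (s C) ↔ Fin n, with φ_C(k) = φ (C , k).

record PathForest : Set where
  field
    n   : ℕ
    c   : ℕ
    s   : Fin c → ℕ
    s≥1 : ∀ C → 1 ≤ s C
    φ   : Σ (Fin c) (λ C → Fin (s C)) ↔ Fin n

  φ_ : (C : Fin c) → Fin (s C) → Fin n
  φ_ C k = Inverse.to φ (C , k)

  GEdge : EdgeSet n
  GEdge e = ∃[ C ] ∃[ a ] ∃[ b ] (toℕ b ≡ suc (toℕ a) × e ≡ pair (φ_ C a) (φ_ C b))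

  comp : Fin n → Fin c
  comp x = proj₁ (Inverse.from φ x)

  w : Fin c → ℕ
  w C = s C / 2

  CondN : Set
  CondN =
    (∃[ C ] 2 ≤ s C)
    × (∀ C → IsOdd (s C) → 1 ≤ n ∸ s C → ∃[ D ] (D ≢ C × 2 ≤ s D))
    × (∀ C → IsEven (s C) → 2 ≤ n ∸ s C → ∃[ D ] (D ≢ C × 2 ≤ s D))

  CondE : EdgeSet c → Set
  CondE H =
    (∀ e → H e → ∣ e ∣ ≡ 2 →
       ∃[ C ] ∃[ D ] (IsEven (s C) × IsOdd (s D) × e ≡ pair C D))
    × (∀ e → H e → ∣ e ∣ ≡ 3 → ∀ C → C ∈ e → IsOdd (s C))

  Bullet : EdgeSet c → EdgeSet n
  Bullet H e =
    (∃[ C ] (IsOdd (s C) × s C ≢ 1 ×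
       ∃[ a ] ∃[ b ] ∃[ d ] (U (s C) a b × U (s C) b d × U (s C) d a
                             × e ≡ triple (φ_ C a) (φ_ C b) (φ_ C d))))
    ⊎ (∃[ C ] ∃[ D ] (H (pair C D) × C ≢ D × IsEven (s C) × IsOdd (s D) ×
       ∃[ a ] ∃[ b ] ∃[ d ] ∃[ i ] ∃[ j ] ∃[ k ]
         (toℕ a ≡ 2 * i × toℕ b ≡ suc (2 * j) × toℕ d ≡ 2 * k ×
          i ≤ j × suc j ≤ w C × k ≤ w D ×
          e ≡ triple (φ_ C a) (φ_ C b) (φ_ D d))))
    ⊎ (∃[ I ] ∃[ J ] ∃[ K ] (H (triple I J K) × I ≢ J × J ≢ K × I ≢ K ×
       ∃[ a ] ∃[ b ] ∃[ d ] ∃[ i ] ∃[ j ] ∃[ k ]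
         (toℕ a ≡ 2 * i × toℕ b ≡ 2 * j × toℕ d ≡ 2 * k ×
          i ≤ w I × j ≤ w J × k ≤ w K ×
          e ≡ triple (φ_ I a) (φ_ J b) (φ_ K d))))

  -- overline M = union of the vertex sets of the components in M
  bar : Subset c → Subset n
  bar M = tabulate (λ x → lookup M (comp x))

-- The components in M are single vertices, so the vertex set of M meets an
-- edge of Γ • H only in vertices contributed through an edge of H: a type-(i)
-- edge lies inside one component with more than one vertex, and the two
-- vertices of the even component of a type-(ii) edge lie outside M.  If an
-- edge of Γ • H meets that vertex set and leaves it, the corresponding edge of
-- H meets M and leaves it; M being a module of H, it meets M in exactly one
-- component, which may be swapped for any other component of M.  The swapped
-- edge of H yields the edge of Γ • H in which the vertex in M is swapped for
-- any other, the new vertex sitting at position 0 = 2·0 of its one-vertex path.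
module Submission where

open import Defs
open import Data.Fin using (Fin; zero; suc; toℕ)
open import Data.Fin.Properties using (toℕ<n)
open import Data.Fin.Subset
  using (Subset; _∈_; _∉_; _⊆_; _∪_; _∩_; _─_; ⁅_⁆; ∣_∣; Nonempty; inside; outside)
open import Data.Fin.Subset.Properties
  using (⊆-antisym; x∈⁅x⁆; x∈⁅y⁆⇒x≡y; x∈p∪q⁺; x∈p∪q⁻; x∈p∩q⁺; x∈p∩q⁻; x∈p∧x∉q⇒x∈p─q;
         p─q⊆p; ∪-assoc; ∪-comm; ∪-identityˡ; ∣⁅x⁆∣≡1)
open import Data.Nat using (ℕ; suc; _*_; _≤_; z≤n)
open import Data.Nat.Properties using (m*n≡1⇒m≡1; n<1⇒n≡0)
open import Data.Product using (_×_; _,_; proj₁; proj₂)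
open import Data.Sum using (_⊎_; inj₁; inj₂; [_,_])
import Data.Sum as Sum
open import Data.Vec using (_∷_; lookup; here; there)
open import Data.Vec.Properties using (lookup∘tabulate; []=⇒lookup; lookup⇒[]=)
open import Function using (_∘_; id)
open import Function.Bundles using (Inverse)
open import Relation.Nullary using (contradiction)
open import Relation.Binary.PropositionalEquality
  using (_≡_; _≢_; refl; sym; trans; cong; subst; ≢-sym; module ≡-Reasoning)

private
  variable
    m : ℕ
    x y z u v : Fin m
    e S : Subset m
    E : EdgeSet m

x∈p─q⇒x∉q : ∀ (p q : Subset m) → x ∈ p ─ q → x ∉ q
x∈p─q⇒x∉q (_ ∷ p) (outside ∷ q) here         = λ ()
x∈p─q⇒x∉q (_ ∷ p) (_ ∷ q)       (there x∈p─q) (there x∈q) = x∈p─q⇒x∉q p q x∈p─q x∈q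

∈-pair⁻ : v ∈ pair x y → v ≡ x ⊎ v ≡ y
∈-pair⁻ {x = x} {y} = Sum.map (x∈⁅y⁆⇒x≡y x) (x∈⁅y⁆⇒x≡y y) ∘ x∈p∪q⁻ ⁅ x ⁆ ⁅ y ⁆

∈-triple⁻ : v ∈ triple x y z → v ≡ x ⊎ v ≡ y ⊎ v ≡ z
∈-triple⁻ {x = x} {y} {z} = Sum.map (x∈⁅y⁆⇒x≡y x) ∈-pair⁻ ∘ x∈p∪q⁻ ⁅ x ⁆ (pair y z)

∈-pair⁺ : v ≡ x ⊎ v ≡ y → v ∈ pair x y
∈-pair⁺ {v = v} = x∈p∪q⁺ ∘ Sum.map (λ { refl → x∈⁅x⁆ v }) (λ { refl → x∈⁅x⁆ v })

∈-triple⁺ : v ≡ x ⊎ v ≡ y ⊎ v ≡ z → v ∈ triple x y z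
∈-triple⁺ {v = v} = x∈p∪q⁺ ∘ Sum.map (λ { refl → x∈⁅x⁆ v }) ∈-pair⁺

triple≡pair∪⁅⁆ : ∀ (x y z : Fin m) → triple x y z ≡ pair x y ∪ ⁅ z ⁆
triple≡pair∪⁅⁆ x y z = sym (∪-assoc ⁅ x ⁆ ⁅ y ⁆ ⁅ z ⁆)

triple-rotate : ∀ (x y z : Fin m) → triple x y z ≡ triple y z x
triple-rotate x y z = begin
  ⁅ x ⁆ ∪ pair y z   ≡⟨ ∪-comm ⁅ x ⁆ (pair y z) ⟩
  pair y z ∪ ⁅ x ⁆   ≡⟨ ∪-assoc ⁅ y ⁆ ⁅ z ⁆ ⁅ x ⁆ ⟩
  triple y z x       ∎
  where open ≡-Reasoning

triple-rotate² : ∀ (x y z : Fin m) → triple x y z ≡ triple z x y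
triple-rotate² x y z = trans (triple-rotate x y z) (triple-rotate y z x)

∩≡⁅⁆ : z ∈ e → z ∈ S → (∀ {v} → v ∈ e → v ∈ S → v ≡ z) → e ∩ S ≡ ⁅ z ⁆
∩≡⁅⁆ {z = z} {e = e} {S} z∈e z∈S unique = ⊆-antisym
  (λ v∈ → let v∈e , v∈S = x∈p∩q⁻ e S v∈ in subst (_∈ ⁅ z ⁆) (sym (unique v∈e v∈S)) (x∈⁅x⁆ z))
  (λ v∈ → subst (λ v → v ∈ e ∩ S) (sym (x∈⁅y⁆⇒x≡y z v∈)) (x∈p∩q⁺ (z∈e , z∈S)))

∪⁅⁆-replace : ∀ (p : Subset m) → z ∉ p → (p ∪ ⁅ z ⁆ ─ ⁅ z ⁆) ∪ ⁅ u ⁆ ≡ p ∪ ⁅ u ⁆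
∪⁅⁆-replace {z = z} {u = u} p z∉p = ⊆-antisym to from
  where
  to : (p ∪ ⁅ z ⁆ ─ ⁅ z ⁆) ∪ ⁅ u ⁆ ⊆ p ∪ ⁅ u ⁆
  to v∈ with x∈p∪q⁻ (p ∪ ⁅ z ⁆ ─ ⁅ z ⁆) ⁅ u ⁆ v∈
  ... | inj₂ v∈⁅u⁆ = x∈p∪q⁺ (inj₂ v∈⁅u⁆)
  ... | inj₁ v∈─ with x∈p∪q⁻ p ⁅ z ⁆ (p─q⊆p (p ∪ ⁅ z ⁆) ⁅ z ⁆ v∈─)
  ...   | inj₁ v∈p  = x∈p∪q⁺ (inj₁ v∈p)
  ...   | inj₂ v∈⁅z⁆ = contradiction v∈⁅z⁆ (x∈p─q⇒x∉q (p ∪ ⁅ z ⁆) ⁅ z ⁆ v∈─)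
  from : p ∪ ⁅ u ⁆ ⊆ (p ∪ ⁅ z ⁆ ─ ⁅ z ⁆) ∪ ⁅ u ⁆
  from v∈ with x∈p∪q⁻ p ⁅ u ⁆ v∈
  ... | inj₂ v∈⁅u⁆ = x∈p∪q⁺ (inj₂ v∈⁅u⁆)
  ... | inj₁ v∈p   = x∈p∪q⁺ (inj₁ (x∈p∧x∉q⇒x∈p─q (x∈p∪q⁺ (inj₁ v∈p))
                       λ v∈⁅z⁆ → z∉p (subst (_∈ p) (x∈⁅y⁆⇒x≡y z v∈⁅z⁆) v∈p)))

triple-replace : z ≢ x → z ≢ y → (triple x y z ─ ⁅ z ⁆) ∪ ⁅ u ⁆ ≡ triple x y u
triple-replace {z = z} {x} {y} {u = u} z≢x z≢y = begin
  (triple x y z ─ ⁅ z ⁆) ∪ ⁅ u ⁆      ≡⟨ cong (λ t → (t ─ ⁅ z ⁆) ∪ ⁅ u ⁆) (triple≡pair∪⁅⁆ x y z) ⟩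
  (pair x y ∪ ⁅ z ⁆ ─ ⁅ z ⁆) ∪ ⁅ u ⁆  ≡⟨ ∪⁅⁆-replace (pair x y) ([ z≢x , z≢y ] ∘ ∈-pair⁻) ⟩
  pair x y ∪ ⁅ u ⁆                  ≡⟨ triple≡pair∪⁅⁆ x y u ⟨
  triple x y u                      ∎
  where open ≡-Reasoning

∣⁅x⁆∪p∣≡1+∣p∣ : ∀ (p : Subset m) → x ∉ p → ∣ ⁅ x ⁆ ∪ p ∣ ≡ suc ∣ p ∣
∣⁅x⁆∪p∣≡1+∣p∣ {x = zero}  (inside ∷ p)  x∉p = contradiction here x∉p
∣⁅x⁆∪p∣≡1+∣p∣ {x = zero}  (outside ∷ p) _   = cong (suc ∘ ∣_∣) (∪-identityˡ p)
∣⁅x⁆∪p∣≡1+∣p∣ {x = suc x} (inside ∷ p)  x∉p = cong suc (∣⁅x⁆∪p∣≡1+∣p∣ p (x∉p ∘ there))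
∣⁅x⁆∪p∣≡1+∣p∣ {x = suc x} (outside ∷ p) x∉p = ∣⁅x⁆∪p∣≡1+∣p∣ p (x∉p ∘ there)

∣pair∣≡2 : x ≢ y → ∣ pair x y ∣ ≡ 2
∣pair∣≡2 {y = y} x≢y =
  trans (∣⁅x⁆∪p∣≡1+∣p∣ ⁅ y ⁆ (x≢y ∘ x∈⁅y⁆⇒x≡y y)) (cong suc (∣⁅x⁆∣≡1 y))

∣triple∣≡3 : x ≢ y → y ≢ z → x ≢ z → ∣ triple x y z ∣ ≡ 3
∣triple∣≡3 {y = y} {z} x≢y y≢z x≢z =
  trans (∣⁅x⁆∪p∣≡1+∣p∣ (pair y z) ([ x≢y , x≢z ] ∘ ∈-pair⁻)) (cong suc (∣pair∣≡2 y≢z))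

module _ {E : EdgeSet m} {M : Subset m} (M-module : IsModule E M)
         {e : Subset m} (Ee : E e) (x∈e : x ∈ e) (x∈M : x ∈ M) (e⊈M : Nonempty (e ─ M)) where

  private
    x∈e∩M : x ∈ e ∩ M
    x∈e∩M = x∈p∩q⁺ (x∈e , x∈M)

  IsModule-∩ : e ∩ M ≡ ⁅ x ⁆
  IsModule-∩ with M-module e Ee (x , x∈e∩M) e⊈M
  ... | z , _ , e∩M≡⁅z⁆ , _ rewrite x∈⁅y⁆⇒x≡y z (subst (x ∈_) e∩M≡⁅z⁆ x∈e∩M) = e∩M≡⁅z⁆

  IsModule-replace : ∀ y → y ∈ M → E ((e ─ ⁅ x ⁆) ∪ ⁅ y ⁆)
  IsModule-replace with M-module e Ee (x , x∈e∩M) e⊈M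
  ... | z , _ , e∩M≡⁅z⁆ , swap rewrite x∈⁅y⁆⇒x≡y z (subst (x ∈_) e∩M≡⁅z⁆ x∈e∩M) = swap

record Pivot (E : EdgeSet m) (S : Subset m) (e : Subset m) : Set where
  field
    {outer₁ outer₂ pivot} : Fin m
    outer₁∉S : outer₁ ∉ S
    outer₂∉S : outer₂ ∉ S
    pivot∈S  : pivot ∈ S
    e≡triple : e ≡ triple outer₁ outer₂ pivot
    swap     : ∀ u → u ∈ S → E (triple outer₁ outer₂ u)

IsModule-fromPivots : (∀ e → E e → Nonempty (e ∩ S) → Nonempty (e ─ S) → Pivot E S e) →
                      IsModule E S
IsModule-fromPivots {E = E} {S = S} pivots e Ee e∩S≠∅ e⊈S with pivots e Ee e∩S≠∅ e⊈S
... | record { outer₁ = x ; outer₂ = y ; pivot = z ; outer₁∉S = x∉S ; outer₂∉S = y∉S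
             ; pivot∈S = z∈S ; e≡triple = refl ; swap = swap } =
  z , z∈S , ∩≡⁅⁆ (∈-triple⁺ (inj₂ (inj₂ refl))) z∈S only-z , λ u u∈S →
    subst E (sym (triple-replace (λ { refl → x∉S z∈S }) (λ { refl → y∉S z∈S }))) (swap u u∈S)
  where
  only-z : ∀ {v} → v ∈ triple x y z → v ∈ S → v ≡ z
  only-z v∈ v∈S with ∈-triple⁻ v∈
  ... | inj₁ refl        = contradiction v∈S x∉S
  ... | inj₂ (inj₁ refl) = contradiction v∈S y∉S
  ... | inj₂ (inj₂ v≡z)  = v≡z

even≢1 : ∀ {m} → IsEven m → m ≢ 1
even≢1 (k , refl) 2k≡1 with m*n≡1⇒m≡1 2 k 2k≡1
... | ()

toℕ-Fin1≡0 : ∀ {m} → m ≡ 1 → (k : Fin m) → toℕ k ≡ 0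
toℕ-Fin1≡0 refl k = n<1⇒n≡0 (toℕ<n k)

module _ (Γ : PathForest) where
  open PathForest Γ

  position : (x : Fin n) → Fin (s (comp x))
  position x = proj₂ (Inverse.from φ x)

  comp-φ : ∀ C k → comp (φ_ C k) ≡ C
  comp-φ C k = cong proj₁ (Inverse.strictlyInverseʳ φ (C , k))

  φ-comp : ∀ x → φ_ (comp x) (position x) ≡ x
  φ-comp = Inverse.strictlyInverseˡ φ

  ∈-bar⁻ : ∀ {M x} → x ∈ bar M → comp x ∈ M
  ∈-bar⁻ {M} {x} x∈ =
    lookup⇒[]= (comp x) M (trans (sym (lookup∘tabulate (lookup M ∘ comp) x)) ([]=⇒lookup x∈))

  φ∈bar⁻ : ∀ {M C k} → φ_ C k ∈ bar M → C ∈ M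
  φ∈bar⁻ {M} {C} {k} = subst (_∈ M) (comp-φ C k) ∘ ∈-bar⁻

  φ∈bar⁺ : ∀ {M C k} → C ∈ M → φ_ C k ∈ bar M
  φ∈bar⁺ {M} {C} {k} C∈M =
    lookup⇒[]= (φ_ C k) (bar M)
      (trans (lookup∘tabulate (lookup M ∘ comp) (φ_ C k))
             ([]=⇒lookup (subst (_∈ M) (sym (comp-φ C k)) C∈M)))

  ∈triple∩bar⁻ : ∀ {M I J K a b d v} → v ∈ triple (φ_ I a) (φ_ J b) (φ_ K d) ∩ bar M →
                 I ∈ M ⊎ J ∈ M ⊎ K ∈ M
  ∈triple∩bar⁻ {M} {v = v} v∈ with x∈p∩q⁻ _ (bar M) v∈
  ... | v∈e , v∈bar with ∈-triple⁻ v∈e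
  ... | inj₁ refl        = inj₁ (φ∈bar⁻ v∈bar)
  ... | inj₂ (inj₁ refl) = inj₂ (inj₁ (φ∈bar⁻ v∈bar))
  ... | inj₂ (inj₂ refl) = inj₂ (inj₂ (φ∈bar⁻ v∈bar))

  module _ (H : EdgeSet c) (M : Subset c)
           (M-module₂ : IsModule (λ e → H e × ∣ e ∣ ≡ 2) M)
           (M-module₃ : IsModule (λ e → H e × ∣ e ∣ ≡ 3) M)
           (M-trivial : ∀ C → C ∈ M → s C ≡ 1) where

    private
      module BarVertex {u : Fin n} (u∈bar : u ∈ bar M) where
        comp∈M : comp u ∈ M
        comp∈M = ∈-bar⁻ u∈bar

        comp-odd : IsOdd (s (comp u))
        comp-odd = 0 , M-trivial (comp u) comp∈M

        position-even : toℕ (position u) ≡ 2 * 0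
        position-even = toℕ-Fin1≡0 (M-trivial (comp u) comp∈M) (position u)

        ∉M⇒≢comp : ∀ {C} → C ∉ M → C ≢ comp u
        ∉M⇒≢comp C∉M refl = C∉M comp∈M

    pivot-ii : ∀ {C D a b d i j} → H (pair C D) → C ≢ D → IsEven (s C) →
               toℕ a ≡ 2 * i → toℕ b ≡ suc (2 * j) → i ≤ j → suc j ≤ w C → D ∈ M →
               Pivot (Bullet H) (bar M) (triple (φ_ C a) (φ_ C b) (φ_ D d))
    pivot-ii {C} {D} {a} {b} {i = i} {j} HCD C≢D C-even a≡2i b≡2j+1 i≤j j<w D∈M = record
      { outer₁∉S = C∉M ∘ φ∈bar⁻
      ; outer₂∉S = C∉M ∘ φ∈bar⁻
      ; pivot∈S  = φ∈bar⁺ D∈M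
      ; e≡triple = refl
      ; swap     = λ u u∈bar → let open BarVertex u∈bar in
          subst (Bullet H) (cong (triple _ _) (φ-comp u)) (inj₂ (inj₁
            (C , comp u , H-swapped (comp u) comp∈M , ∉M⇒≢comp C∉M , C-even , comp-odd ,
             a , b , position u , i , j , 0 , a≡2i , b≡2j+1 , position-even , i≤j , j<w , z≤n ,
             refl)))
      }
      where
      C∉M : C ∉ M
      C∉M = even≢1 C-even ∘ M-trivial C

      H-swapped : ∀ D′ → D′ ∈ M → H (pair C D′)
      H-swapped D′ D′∈M = subst H (∪⁅⁆-replace ⁅ C ⁆ (C≢D ∘ sym ∘ x∈⁅y⁆⇒x≡y C))
        (proj₁ (IsModule-replace M-module₂ (HCD , ∣pair∣≡2 C≢D) (∈-pair⁺ (inj₂ refl)) D∈M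
                  (C , x∈p∧x∉q⇒x∈p─q (∈-pair⁺ (inj₁ refl)) C∉M) D′ D′∈M))

    pivot-iii : ∀ {e I J K a b d i j} → H (triple I J K) → I ≢ J → J ≢ K → I ≢ K →
                toℕ a ≡ 2 * i → toℕ b ≡ 2 * j → i ≤ w I → j ≤ w J → K ∈ M →
                e ≡ triple (φ_ I a) (φ_ J b) (φ_ K d) → Nonempty (e ─ bar M) →
                Pivot (Bullet H) (bar M) e
    pivot-iii {I = I} {J} {K} {a} {b} {i = i} {j}
              HIJK I≢J J≢K I≢K a≡2i b≡2j I-range J-range K∈M refl (v , v∈e─bar) = record
      { outer₁∉S = I∉M ∘ φ∈bar⁻
      ; outer₂∉S = J∉M ∘ φ∈bar⁻
      ; pivot∈S  = φ∈bar⁺ K∈M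
      ; e≡triple = refl
      ; swap     = λ u u∈bar → let open BarVertex u∈bar in
          subst (Bullet H) (cong (triple _ _) (φ-comp u)) (inj₂ (inj₂
            (I , J , comp u , H-swapped (comp u) comp∈M , I≢J , ∉M⇒≢comp J∉M , ∉M⇒≢comp I∉M ,
             a , b , position u , i , j , 0 , a≡2i , b≡2j , position-even ,
             I-range , J-range , z≤n , refl)))
      }
      where
      HIJK₃ : H (triple I J K) × ∣ triple I J K ∣ ≡ 3
      HIJK₃ = HIJK , ∣triple∣≡3 I≢J J≢K I≢K

      K∈IJK : K ∈ triple I J K
      K∈IJK = ∈-triple⁺ (inj₂ (inj₂ refl))

      IJK⊈M : Nonempty (triple I J K ─ M)
      IJK⊈M with ∈-triple⁻ (p─q⊆p _ (bar M) v∈e─bar) | x∈p─q⇒x∉q _ (bar M) v∈e─bar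
      ... | inj₁ refl        | v∉bar = I , x∈p∧x∉q⇒x∈p─q (∈-triple⁺ (inj₁ refl)) (v∉bar ∘ φ∈bar⁺)
      ... | inj₂ (inj₁ refl) | v∉bar =
        J , x∈p∧x∉q⇒x∈p─q (∈-triple⁺ (inj₂ (inj₁ refl))) (v∉bar ∘ φ∈bar⁺)
      ... | inj₂ (inj₂ refl) | v∉bar = contradiction (φ∈bar⁺ K∈M) v∉bar

      only-K : ∀ {X} → X ∈ triple I J K → X ∈ M → X ≡ K
      only-K X∈ X∈M = x∈⁅y⁆⇒x≡y K
        (subst (_ ∈_) (IsModule-∩ M-module₃ HIJK₃ K∈IJK K∈M IJK⊈M) (x∈p∩q⁺ (X∈ , X∈M)))

      I∉M : I ∉ M
      I∉M = I≢K ∘ only-K (∈-triple⁺ (inj₁ refl))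

      J∉M : J ∉ M
      J∉M = J≢K ∘ only-K (∈-triple⁺ (inj₂ (inj₁ refl)))

      H-swapped : ∀ K′ → K′ ∈ M → H (triple I J K′)
      H-swapped K′ K′∈M = subst H (triple-replace (≢-sym I≢K) (≢-sym J≢K))
        (proj₁ (IsModule-replace M-module₃ HIJK₃ K∈IJK K∈M IJK⊈M K′ K′∈M))

    bullet-pivot : ∀ e → Bullet H e → Nonempty (e ∩ bar M) → Nonempty (e ─ bar M) →
                   Pivot (Bullet H) (bar M) e
    bullet-pivot _ (inj₁ (C , _ , s≢1 , _ , _ , _ , _ , _ , _ , refl)) (_ , v∈) _ =
      contradiction (M-trivial C ([ id , [ id , id ] ] (∈triple∩bar⁻ v∈))) s≢1
    bullet-pivot _ (inj₂ (inj₁ (C , D , HCD , C≢D , C-even , _ ,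
                               _ , _ , _ , i , j , _ , a≡2i , b≡2j+1 , _ , i≤j , j<w , _ , refl)))
                 (_ , v∈) _
      with ∈triple∩bar⁻ v∈
    ... | inj₁ C∈M        = contradiction (M-trivial C C∈M) (even≢1 C-even)
    ... | inj₂ (inj₁ C∈M) = contradiction (M-trivial C C∈M) (even≢1 C-even)
    ... | inj₂ (inj₂ D∈M) = pivot-ii HCD C≢D C-even a≡2i b≡2j+1 i≤j j<w D∈M
    bullet-pivot _ (inj₂ (inj₂ (I , J , K , HIJK , I≢J , J≢K , I≢K ,
                               _ , _ , _ , _ , _ , _ , a≡2i , b≡2j , d≡2k ,
                               I-range , J-range , K-range , refl)))
                 (_ , v∈) e⊈bar
      with ∈triple∩bar⁻ v∈
    ... | inj₂ (inj₂ K∈M) = pivot-iii HIJK I≢J J≢K I≢K a≡2i b≡2j I-range J-range K∈M refl e⊈bar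
    ... | inj₁ I∈M =
      pivot-iii (subst H (triple-rotate I J K) HIJK) J≢K (≢-sym I≢K) (≢-sym I≢J)
                b≡2j d≡2k J-range K-range I∈M (triple-rotate _ _ _) e⊈bar
    ... | inj₂ (inj₁ J∈M) =
      pivot-iii (subst H (triple-rotate² I J K) HIJK) (≢-sym I≢K) I≢J (≢-sym J≢K)
                d≡2k a≡2i K-range I-range J∈M (triple-rotate² _ _ _) e⊈bar

mainTheorem16 : (Γ : PathForest) → PathForest.CondN Γ →
    (H : EdgeSet (PathForest.c Γ)) → Is23Hypergraph H → PathForest.CondE Γ H →
    (M : Subset (PathForest.c Γ)) → IsModule23 H M →
    (∀ C → C ∈ M → PathForest.s Γ C ≡ 1) →
    IsModule (PathForest.Bullet Γ H) (PathForest.bar Γ M)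
mainTheorem16 Γ _ H _ _ M (M-module₂ , M-module₃) M-trivial =
  IsModule-fromPivots (bullet-pivot Γ H M M-module₂ M-module₃ M-trivial)
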